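{- $A$ has no submatrices of the following forms, where $x$, $y$, and $z$ are distinct non-zero entries: \[(i)\ \begin{bmatrix} x&y\\ 0&x \end{bmatrix};\ (ii)\ \begin{bmatrix} x&y\\ y&x \end{bmatrix};\ (iii)\ \begin{bmatrix} x&x\\ y&z \end{bmatrix};\ (iv)\ \begin{bmatrix} x&y\\ z&x \end{bmatrix}.\]
   Context: Let $M$ be a $\mathrm{GF}(4)$-representable matroid on $E$ with a circuit-hyperplane $X$; choose $e\in X$, $f\in E-X$ with $(X-e)\cup f$ a basis of $M$, and write $M=M[I\mid C]$ with $C=\begin{bmatrix} A & \underline{1}\\ \underline{1}^{T} & 0\end{bmatrix}$ (rows $(X-e)\cup f$, columns $((E-X)-f)\cup e$, row $f$ and column $e$ last, all non-zero entries of row $f$ and column $e$ scaled to $1$). Let $M'$ be obtained from $M$ by relaxing $X$, and suppose $M'$ is $\mathrm{GF}(4)$-representable with reduced representation $M'=M[I\mid C']$, $C'=\begin{bmatrix} A' & \underline{1}\\ \underline{1}^{T} & \omega\end{bmatrix}$ with the same labels, where the $(f,e)$ entry is $\omega\in\mathrm{GF}(4)-\{0,1\}$ and all other entries of row $f$ and column $e$ are $1$. -}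

module Defs where

open import Data.Nat using (ℕ; zero; suc)
open import Data.Fin using (Fin; zero; suc)
open import Data.Maybe using (Maybe; just; nothing)
open import Data.Sum using (_⊎_; inj₁; inj₂)
open import Data.Product using (_×_; Σ; ∃; _,_)
open import Data.Bool using (Bool; true; false)
open import Relation.Binary.PropositionalEquality using (_≡_; _≢_)
open import Relation.Nullary using (¬_)

data GF4 : Set where
  𝟘 𝟙 ω ω² : GF4

infixl 6 _⊕_
infixl 7 _⊗_

_⊕_ : GF4 → GF4 → GF4
𝟘  ⊕ b  = b
a  ⊕ 𝟘  = a
𝟙  ⊕ 𝟙  = 𝟘
𝟙  ⊕ ω  = ω²
𝟙  ⊕ ω² = ω
ω  ⊕ 𝟙  = ω²
ω  ⊕ ω  = 𝟘
ω  ⊕ ω² = 𝟙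
ω² ⊕ 𝟙  = ω
ω² ⊕ ω  = 𝟙
ω² ⊕ ω² = 𝟘

_⊗_ : GF4 → GF4 → GF4
𝟘  ⊗ b  = 𝟘
a  ⊗ 𝟘  = 𝟘
𝟙  ⊗ b  = b
a  ⊗ 𝟙  = a
ω  ⊗ ω  = ω²
ω  ⊗ ω² = 𝟙
ω² ⊗ ω  = 𝟙
ω² ⊗ ω² = ω

-- Finite index types.  A row/column label set of size (1 + k) is
-- Maybe (Fin k); 'nothing' is the distinguished last label.

sumFin : ∀ n → (Fin n → GF4) → GF4
sumFin zero    g = 𝟘
sumFin (suc n) g = g zero ⊕ sumFin n (λ i → g (suc i))

sumMaybe : ∀ n → (Maybe (Fin n) → GF4) → GF4
sumMaybe n g = g nothing ⊕ sumFin n (λ i → g (just i))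

countFin : ∀ n → (Fin n → Bool) → ℕ
countFin zero    g = zero
countFin (suc n) g = (if g zero then suc else (λ k → k)) (countFin n (λ i → g (suc i)))
  where
  if_then_else_ : {A : Set} → Bool → A → A → A
  if true  then a else b = a
  if false then a else b = b

countMaybe : ∀ n → (Maybe (Fin n) → Bool) → ℕ
countMaybe n g = countFin (suc n) h
  where
  h : Fin (suc n) → Bool
  h zero    = g nothing
  h (suc i) = g (just i)

-- Rows    : Maybe (Fin p)  (just i = element i of X - e,   nothing = f)
-- Columns : Maybe (Fin q)  (just j = element j of (E-X)-f, nothing = e)
-- Ground set E = rows ⊎ columns.

Row : ℕ → Set
Row p = Maybe (Fin p)

Col : ℕ → Set
Col q = Maybe (Fin q)

Ground : ℕ → ℕ → Set
Ground p q = Row p ⊎ Col q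

Mat : ℕ → ℕ → Set
Mat p q = Fin p → Fin q → GF4

bordered : ∀ {p q} → Mat p q → GF4 → Row p → Col q → GF4
bordered A d (just i) (just j) = A i j
bordered A d (just i) nothing  = 𝟙
bordered A d nothing  (just j) = 𝟙
bordered A d nothing  nothing  = d

eqRow : ∀ {p} → Row p → Row p → Bool
eqRow nothing  nothing  = true
eqRow nothing  (just _) = false
eqRow (just _) nothing  = false
eqRow (just i) (just j) = eqFin i j
  where
  eqFin : ∀ {n} → Fin n → Fin n → Bool
  eqFin zero    zero    = true
  eqFin zero    (suc _) = false
  eqFin (suc _) zero    = false
  eqFin (suc a) (suc b) = eqFin a b

-- column of [I | C] labelled by x, as a vector indexed by rows
column : ∀ {p q} → (Row p → Col q → GF4) → Ground p q → Row p → GF4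
column C (inj₁ r) i with eqRow r i
... | true  = 𝟙
... | false = 𝟘
column C (inj₂ c) i = C i c

Subset : ℕ → ℕ → Set
Subset p q = Ground p q → Bool

size : ∀ {p q} → Subset p q → ℕ
size {p} {q} S = countMaybe p (λ r → S (inj₁ r)) Data.Nat.+ countMaybe q (λ c → S (inj₂ c))

_≐_ : ∀ {p q} → Subset p q → Subset p q → Set
S ≐ T = ∀ x → S x ≡ T x

_⊂_ : ∀ {p q} → Subset p q → Subset p q → Set
S ⊂ T = (∀ x → S x ≡ true → T x ≡ true) × ¬ (S ≐ T)

lincomb : ∀ {p q} → (Row p → Col q → GF4) → (Ground p q → GF4) → Row p → GF4
lincomb {p} {q} C c i =
  sumMaybe p (λ r → c (inj₁ r) ⊗ column C (inj₁ r) i)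
  ⊕ sumMaybe q (λ k → c (inj₂ k) ⊗ column C (inj₂ k) i)

Independent : ∀ {p q} → (Row p → Col q → GF4) → Subset p q → Set
Independent C S =
  (c : _ → GF4) → (∀ x → S x ≡ false → c x ≡ 𝟘) →
  (∀ i → lincomb C c i ≡ 𝟘) → ∀ x → c x ≡ 𝟘

-- bases of M[I|C]: independent sets of size r(M) = p + 1 (number of rows)
IsBasis : ∀ {p q} → (Row p → Col q → GF4) → Subset p q → Set
IsBasis {p} C S = Independent C S × size S ≡ suc p

Spanning : ∀ {p q} → (Row p → Col q → GF4) → Subset p q → Set
Spanning C S = Σ _ λ B → IsBasis C B × (∀ x → B x ≡ true → S x ≡ true)

IsCircuit : ∀ {p q} → (Row p → Col q → GF4) → Subset p q → Set
IsCircuit C S = ¬ Independent C S × (∀ T → T ⊂ S → Independent C T)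

insert : ∀ {p q} → Subset p q → Ground p q → Subset p q
insert S x y with S y
... | true  = true
... | false = eqG x y
  where
  eqG : Ground _ _ → Ground _ _ → Bool
  eqG (inj₁ a) (inj₁ b) = eqRow a b
  eqG (inj₁ _) (inj₂ _) = false
  eqG (inj₂ _) (inj₁ _) = false
  eqG (inj₂ nothing) (inj₂ nothing) = true
  eqG (inj₂ nothing) (inj₂ (just _)) = false
  eqG (inj₂ (just _)) (inj₂ nothing) = false
  eqG (inj₂ (just a)) (inj₂ (just b)) = eqRow {_} (just a) (just b)

IsHyperplane : ∀ {p q} → (Row p → Col q → GF4) → Subset p q → Set
IsHyperplane C H = ¬ Spanning C H × (∀ x → H x ≡ false → Spanning C (insert H x))

IsCircuitHyperplane : ∀ {p q} → (Row p → Col q → GF4) → Subset p q → Set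
IsCircuitHyperplane C X = IsCircuit C X × IsHyperplane C X

Xset : ∀ {p q} → Subset p q
Xset (inj₁ (just _)) = true
Xset (inj₁ nothing)  = false
Xset (inj₂ (just _)) = false
Xset (inj₂ nothing)  = true

IsRelaxedBasis : ∀ {p q} → (Row p → Col q → GF4) → Subset p q → Subset p q → Set
IsRelaxedBasis C X S = IsBasis C S ⊎ (S ≐ X)

NZDistinct2 : GF4 → GF4 → Set
NZDistinct2 x y = x ≢ 𝟘 × y ≢ 𝟘 × x ≢ y

NZDistinct3 : GF4 → GF4 → GF4 → Set
NZDistinct3 x y z = NZDistinct2 x y × z ≢ 𝟘 × x ≢ z × y ≢ z

Forbidden : GF4 → GF4 → GF4 → GF4 → Set
Forbidden a b c d =
    (∃ λ x → ∃ λ y → NZDistinct2 x y × a ≡ x × b ≡ y × c ≡ 𝟘 × d ≡ x)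
  ⊎ (∃ λ x → ∃ λ y → NZDistinct2 x y × a ≡ x × b ≡ y × c ≡ y × d ≡ x)
  ⊎ (∃ λ x → ∃ λ y → ∃ λ z → NZDistinct3 x y z × a ≡ x × b ≡ x × c ≡ y × d ≡ z)
  ⊎ (∃ λ x → ∃ λ y → ∃ λ z → NZDistinct3 x y z × a ≡ x × b ≡ y × c ≡ z × d ≡ x)

HasForbiddenSubmatrix : ∀ {p q} → Mat p q → Set
HasForbiddenSubmatrix {p} {q} A =
  Σ (Fin p) λ i₁ → Σ (Fin p) λ i₂ → Σ (Fin q) λ j₁ → Σ (Fin q) λ j₂ →
    i₁ ≢ i₂ × j₁ ≢ j₂ × Forbidden (A i₁ j₁) (A i₁ j₂) (A i₂ j₁) (A i₂ j₂)

-- M = M[I | C] and its relaxation M′ = M[I | C′] have the same bases apart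
-- from X. Exchanging the rows of a square submatrix of C for its columns in the
-- identity basis gives a basis exactly when that submatrix is nonsingular, and
-- gives X only for the (f, e) entry. Hence every square submatrix meeting A is
-- nonsingular in C iff it is nonsingular in C′. On the 3×3 submatrix with rows
-- i₁, i₂, f and columns j₁, j₂, e this yields eighteen conditions linking the
-- entries of A and A′ there and the corner w, and an exhaustive check over GF(4)
-- shows that for w ∉ {0, 1} they fail whenever the 2×2 block of A has one of
-- the forms (i)–(iv).

module Submission where

open import Defs
open import Data.Bool using (Bool; true; false; T; not; _∧_; _∨_; if_then_else_)
import Data.Bool.Properties as Bool
open import Data.Empty using (⊥-elim)
open import Data.Fin using (Fin; zero; suc)
import Data.Fin.Properties as Fin
open import Data.List using (List; []; _∷_; _++_; cartesianProductWith; filter)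
open import Data.List.Relation.Unary.All as All using (All; all?)
open import Data.Maybe using (Maybe; just; nothing)
import Data.Maybe as Maybe
import Data.Maybe.Properties as Maybe
open import Data.Nat using (ℕ; zero; suc; _+_)
open import Data.Nat.Properties using (+-suc)
open import Data.Product using (_×_; ∃; ∃₂; _,_; proj₁; proj₂)
open import Data.Sum using (_⊎_; inj₁; inj₂; [_,_])
open import Data.Vec using (Vec; []; _∷_; lookup; tabulate)
open import Data.Vec.Properties using (lookup∘tabulate)
open import Function using (_∘_; _⇔_; mk⇔; Equivalence)
open import Function.Definitions using (Injective)
open import Function.Properties.Equivalence using (⇔-setoid)
open import Level using (0ℓ)
open import Relation.Binary.Definitions using (DecidableEquality)
open import Relation.Binary.PropositionalEquality
  using (_≡_; _≢_; refl; sym; trans; cong; cong₂; module ≡-Reasoning)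
import Relation.Binary.Reasoning.Setoid as SetoidReasoning
open import Relation.Nullary using (¬_; Dec; yes; no; does; contradiction)
open import Relation.Nullary.Decidable
  using (map′; ¬?; _×-dec_; _⊎-dec_; _→-dec_; from-yes; toWitness; fromWitness; T?; isYes;
         dec-true; dec-false)

private
  variable
    k n p q : ℕ

infix 4 _≟_
_≟_ : DecidableEquality GF4
𝟘  ≟ 𝟘  = yes refl
𝟘  ≟ 𝟙  = no λ ()
𝟘  ≟ ω  = no λ ()
𝟘  ≟ ω² = no λ ()
𝟙  ≟ 𝟘  = no λ ()
𝟙  ≟ 𝟙  = yes refl
𝟙  ≟ ω  = no λ ()
𝟙  ≟ ω² = no λ ()
ω  ≟ 𝟘  = no λ ()
ω  ≟ 𝟙  = no λ ()
ω  ≟ ω  = yes refl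
ω  ≟ ω² = no λ ()
ω² ≟ 𝟘  = no λ ()
ω² ≟ 𝟙  = no λ ()
ω² ≟ ω  = no λ ()
ω² ≟ ω² = yes refl

every : (GF4 → Bool) → Bool
every f = f 𝟘 ∧ f 𝟙 ∧ f ω ∧ f ω²

T-every : ∀ f → T (every f) ⇔ (∀ x → T (f x))
T-every f = mk⇔ sound complete
  where
  split : ∀ a {b} → T (a ∧ b) → T a × T b
  split a = Equivalence.to (Bool.T-∧ {a})
  sound : T (every f) → ∀ x → T (f x)
  sound t 𝟘  = proj₁ (split (f 𝟘) t)
  sound t 𝟙  = proj₁ (split (f 𝟙) (proj₂ (split (f 𝟘) t)))
  sound t ω  = proj₁ (split (f ω) (proj₂ (split (f 𝟙) (proj₂ (split (f 𝟘) t)))))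
  sound t ω² = proj₂ (split (f ω) (proj₂ (split (f 𝟙) (proj₂ (split (f 𝟘) t)))))
  join : ∀ a {b} → T a → T b → T (a ∧ b)
  join a ta tb = Equivalence.from (Bool.T-∧ {a}) (ta , tb)
  complete : (∀ x → T (f x)) → T (every f)
  complete h = join (f 𝟘) (h 𝟘) (join (f 𝟙) (h 𝟙) (join (f ω) (h ω) (h ω²)))

-- Deciding through the Boolean 'every' rather than a nest of product decisions
-- keeps the exhaustive checks below cheap to normalise.
∀-GF4? : {P : GF4 → Set} → (∀ x → Dec (P x)) → Dec (∀ x → P x)
∀-GF4? P? = map′ (λ t x → toWitness {a? = P? x} (Equivalence.to (T-every (isYes ∘ P?)) t x))
                 (λ h → Equivalence.from (T-every (isYes ∘ P?)) (λ x → fromWitness (h x)))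
                 (T? (every (isYes ∘ P?)))

∃-GF4? : {P : GF4 → Set} → (∀ x → Dec (P x)) → Dec (∃ P)
∃-GF4? {P} P? = map′ witness locate (P? 𝟘 ⊎-dec P? 𝟙 ⊎-dec P? ω ⊎-dec P? ω²)
  where
  witness : P 𝟘 ⊎ P 𝟙 ⊎ P ω ⊎ P ω² → ∃ P
  witness (inj₁ p)               = 𝟘 , p
  witness (inj₂ (inj₁ p))        = 𝟙 , p
  witness (inj₂ (inj₂ (inj₁ p))) = ω , p
  witness (inj₂ (inj₂ (inj₂ p))) = ω² , p
  locate : ∃ P → P 𝟘 ⊎ P 𝟙 ⊎ P ω ⊎ P ω²
  locate (𝟘 , p)  = inj₁ p
  locate (𝟙 , p)  = inj₂ (inj₁ p)
  locate (ω , p)  = inj₂ (inj₂ (inj₁ p))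
  locate (ω² , p) = inj₂ (inj₂ (inj₂ p))

⊕-identityʳ : ∀ a → a ⊕ 𝟘 ≡ a
⊕-identityʳ = from-yes (∀-GF4? λ a → a ⊕ 𝟘 ≟ a)

x⊕x≡𝟘 : ∀ a → a ⊕ a ≡ 𝟘
x⊕x≡𝟘 = from-yes (∀-GF4? λ a → a ⊕ a ≟ 𝟘)

⊕-interchange : ∀ a b c d → (a ⊕ b) ⊕ (c ⊕ d) ≡ (a ⊕ c) ⊕ (b ⊕ d)
⊕-interchange = from-yes (∀-GF4? λ a → ∀-GF4? λ b → ∀-GF4? λ c → ∀-GF4? λ d →
  (a ⊕ b) ⊕ (c ⊕ d) ≟ (a ⊕ c) ⊕ (b ⊕ d))

⊗-comm : ∀ a b → a ⊗ b ≡ b ⊗ a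
⊗-comm = from-yes (∀-GF4? λ a → ∀-GF4? λ b → a ⊗ b ≟ b ⊗ a)

⊗-zeroʳ : ∀ a → a ⊗ 𝟘 ≡ 𝟘
⊗-zeroʳ = from-yes (∀-GF4? λ a → a ⊗ 𝟘 ≟ 𝟘)

⊗-identityʳ : ∀ a → a ⊗ 𝟙 ≡ a
⊗-identityʳ = from-yes (∀-GF4? λ a → a ⊗ 𝟙 ≟ a)

⊗-distribʳ-⊕ : ∀ a b c → (a ⊕ b) ⊗ c ≡ a ⊗ c ⊕ b ⊗ c
⊗-distribʳ-⊕ = from-yes (∀-GF4? λ a → ∀-GF4? λ b → ∀-GF4? λ c →
  (a ⊕ b) ⊗ c ≟ a ⊗ c ⊕ b ⊗ c)

-- sumMaybe n g and countMaybe n g are definitionally sumFin (suc n) (g ∘ toMaybe)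
-- and countFin (suc n) (g ∘ toMaybe), so lemmas over Fin apply to labels.
toMaybe : Fin (suc n) → Maybe (Fin n)
toMaybe zero    = nothing
toMaybe (suc i) = just i

sumFin-cong : ∀ n {f g : Fin n → GF4} → (∀ i → f i ≡ g i) → sumFin n f ≡ sumFin n g
sumFin-cong zero    f≗g = refl
sumFin-cong (suc n) f≗g = cong₂ _⊕_ (f≗g zero) (sumFin-cong n (f≗g ∘ suc))

sumFin-zero : ∀ n {f : Fin n → GF4} → (∀ i → f i ≡ 𝟘) → sumFin n f ≡ 𝟘
sumFin-zero zero    f≗0 = refl
sumFin-zero (suc n) f≗0 = cong₂ _⊕_ (f≗0 zero) (sumFin-zero n (f≗0 ∘ suc))

sumMaybe-cong : ∀ n {f g : Maybe (Fin n) → GF4} → (∀ r → f r ≡ g r) → sumMaybe n f ≡ sumMaybe n g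
sumMaybe-cong n f≗g = cong₂ _⊕_ (f≗g nothing) (sumFin-cong n (f≗g ∘ just))

sumFin-⊕ : ∀ n (f g : Fin n → GF4) → sumFin n (λ i → f i ⊕ g i) ≡ sumFin n f ⊕ sumFin n g
sumFin-⊕ zero    f g = refl
sumFin-⊕ (suc n) f g = trans (cong (f zero ⊕ g zero ⊕_) (sumFin-⊕ n (f ∘ suc) (g ∘ suc)))
                             (⊕-interchange (f zero) (g zero) _ _)

sumFin-⊗ʳ : ∀ n (f : Fin n → GF4) c → sumFin n f ⊗ c ≡ sumFin n (λ i → f i ⊗ c)
sumFin-⊗ʳ zero    f c = refl
sumFin-⊗ʳ (suc n) f c = trans (⊗-distribʳ-⊕ (f zero) _ c)
                              (cong (f zero ⊗ c ⊕_) (sumFin-⊗ʳ n (f ∘ suc) c))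

sumFin-comm : ∀ m n (F : Fin m → Fin n → GF4) →
  sumFin m (λ i → sumFin n (F i)) ≡ sumFin n (λ j → sumFin m (λ i → F i j))
sumFin-comm zero    n F = sym (sumFin-zero n (λ _ → refl))
sumFin-comm (suc m) n F = trans (cong (sumFin n (F zero) ⊕_) (sumFin-comm m n (F ∘ suc)))
                                (sym (sumFin-⊕ n (F zero) _))

sumMaybe-sumFin-comm : ∀ n k (F : Maybe (Fin n) → Fin k → GF4) →
  sumMaybe n (λ r → sumFin k (F r)) ≡ sumFin k (λ t → sumMaybe n (λ r → F r t))
sumMaybe-sumFin-comm n k F = sumFin-comm (suc n) k (F ∘ toMaybe)

sumFin-select : ∀ n (f : Fin n → GF4) i → (∀ j → j ≢ i → f j ≡ 𝟘) → sumFin n f ≡ f i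
sumFin-select (suc n) f zero    off =
  trans (cong (f zero ⊕_) (sumFin-zero n (λ j → off (suc j) λ ()))) (⊕-identityʳ (f zero))
sumFin-select (suc n) f (suc i) off =
  cong₂ _⊕_ (off zero λ ()) (sumFin-select n (f ∘ suc) i (λ j j≢i → off (suc j) (j≢i ∘ Fin.suc-injective)))

sumMaybe-select : ∀ n (g : Maybe (Fin n) → GF4) r → (∀ r′ → r′ ≢ r → g r′ ≡ 𝟘) →
  sumMaybe n g ≡ g r
sumMaybe-select n g nothing  off =
  trans (cong (g nothing ⊕_) (sumFin-zero n (λ i → off (just i) λ ()))) (⊕-identityʳ (g nothing))
sumMaybe-select n g (just i) off =
  cong₂ _⊕_ (off nothing λ ())
            (sumFin-select n (g ∘ just) i (λ j j≢i → off (just j) (j≢i ∘ Maybe.just-injective)))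

countFin-none : ∀ n {f : Fin n → Bool} → (∀ i → f i ≡ false) → countFin n f ≡ 0
countFin-none zero    f≗false = refl
countFin-none (suc n) {f} f≗false with f zero | f≗false zero
... | false | refl = countFin-none n (f≗false ∘ suc)

countFin-∨ : ∀ n (f g : Fin n → Bool) → (∀ i → f i ≡ false ⊎ g i ≡ false) →
  countFin n (λ i → f i ∨ g i) ≡ countFin n f + countFin n g
countFin-∨ zero    f g disjoint = refl
countFin-∨ (suc n) f g disjoint with f zero | g zero | disjoint zero
... | true  | true  | inj₁ ()
... | true  | true  | inj₂ ()
... | true  | false | _ = cong suc (countFin-∨ n (f ∘ suc) (g ∘ suc) (disjoint ∘ suc))
... | false | true  | _ = trans (cong suc (countFin-∨ n (f ∘ suc) (g ∘ suc) (disjoint ∘ suc)))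
                               (sym (+-suc (countFin n (f ∘ suc)) _))
... | false | false | _ = countFin-∨ n (f ∘ suc) (g ∘ suc) (disjoint ∘ suc)

countFin-not : ∀ n (f : Fin n → Bool) → countFin n (not ∘ f) + countFin n f ≡ n
countFin-not zero    f = refl
countFin-not (suc n) f with f zero
... | true  = trans (+-suc (countFin n (not ∘ f ∘ suc)) _) (cong suc (countFin-not n (f ∘ suc)))
... | false = cong suc (countFin-not n (f ∘ suc))

infix 4 _≟ᵐ_
_≟ᵐ_ : DecidableEquality (Maybe (Fin n))
_≟ᵐ_ = Maybe.≡-dec Fin._≟_

δ : Maybe (Fin n) → Maybe (Fin n) → GF4
δ r r′ = if does (r ≟ᵐ r′) then 𝟙 else 𝟘

δ-refl : ∀ (r : Maybe (Fin n)) → δ r r ≡ 𝟙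
δ-refl r rewrite dec-true (r ≟ᵐ r) refl = refl

δ-≢ : ∀ {r r′ : Maybe (Fin n)} → r ≢ r′ → δ r r′ ≡ 𝟘
δ-≢ {r = r} {r′} r≢r′ rewrite dec-false (r ≟ᵐ r′) r≢r′ = refl

⊗-δ-refl : ∀ a (r : Maybe (Fin n)) → a ⊗ δ r r ≡ a
⊗-δ-refl a r = trans (cong (a ⊗_) (δ-refl r)) (⊗-identityʳ a)

⊗-δ-≢ : ∀ a {r r′ : Maybe (Fin n)} → r ≢ r′ → a ⊗ δ r r′ ≡ 𝟘
⊗-δ-≢ a r≢r′ = trans (cong (a ⊗_) (δ-≢ r≢r′)) (⊗-zeroʳ a)

eqRow-does : ∀ (r r′ : Row p) → eqRow r r′ ≡ does (r ≟ᵐ r′)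
eqRow-does nothing        nothing        = refl
eqRow-does nothing        (just _)       = refl
eqRow-does (just _)       nothing        = refl
eqRow-does (just zero)    (just zero)    = refl
eqRow-does (just zero)    (just (suc _)) = refl
eqRow-does (just (suc _)) (just zero)    = refl
eqRow-does (just (suc i)) (just (suc j)) = eqRow-does (just i) (just j)

column-identity : ∀ (C : Row p → Col q → GF4) r i → column C (inj₁ r) i ≡ δ r i
column-identity C r i rewrite eqRow-does r i with does (r ≟ᵐ i)
... | true  = refl
... | false = refl

inImage : (Fin k → Maybe (Fin n)) → Maybe (Fin n) → Bool
inImage R r = does (Fin.any? λ s → R s ≟ᵐ r)

inImage-true : ∀ (R : Fin k → Maybe (Fin n)) {s r} → R s ≡ r → inImage R r ≡ true
inImage-true R {s} Rs≡r = dec-true (Fin.any? λ s′ → R s′ ≟ᵐ _) (s , Rs≡r)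

countFin-≟ : ∀ n (i : Fin n) → countFin n (λ j → does (i Fin.≟ j)) ≡ 1
countFin-≟ (suc n) zero    = cong suc (countFin-none n (λ _ → refl))
countFin-≟ (suc n) (suc i) = countFin-≟ n i

countMaybe-≟ : ∀ n (r : Maybe (Fin n)) → countMaybe n (λ r′ → does (r ≟ᵐ r′)) ≡ 1
countMaybe-≟ n nothing  = cong suc (countFin-none n (λ _ → refl))
countMaybe-≟ n (just i) = countFin-≟ n i

countMaybe-image : ∀ n (R : Fin k → Maybe (Fin n)) → Injective _≡_ _≡_ R →
  countMaybe n (inImage R) ≡ k
countMaybe-image {zero}  n R R-inj = countFin-none (suc n) {inImage R ∘ toMaybe} (λ _ → refl)
countMaybe-image {suc k} n R R-inj =
  trans (countFin-∨ (suc n) (λ i → does (R zero ≟ᵐ toMaybe i)) (inImage (R ∘ suc) ∘ toMaybe) disjoint)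
        (cong₂ _+_ (countMaybe-≟ n (R zero)) (countMaybe-image n (R ∘ suc) (Fin.suc-injective ∘ R-inj)))
  where
  disjoint : ∀ i → does (R zero ≟ᵐ toMaybe i) ≡ false ⊎ inImage (R ∘ suc) (toMaybe i) ≡ false
  disjoint i with R zero ≟ᵐ toMaybe i | Fin.any? (λ s → R (suc s) ≟ᵐ toMaybe i)
  ... | no _     | _             = inj₁ refl
  ... | yes _    | no _          = inj₂ refl
  ... | yes R₀≡i | yes (s , Rs≡i) = ⊥-elim (Fin.0≢1+n (R-inj (trans R₀≡i (sym Rs≡i))))

record Minor (p q : ℕ) : Set where
  constructor minor
  field
    order : ℕ
    rows  : Fin order → Row p
    cols  : Fin order → Col q

_[_] : (Row p → Col q → GF4) → (m : Minor p q) → Mat (Minor.order m) (Minor.order m)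
C [ minor _ R K ] = λ s t → C (R s) (K t)

-- The identity columns, i.e. the row labels, with those of the minor replaced by its columns.
Exchange : Minor p q → Subset p q
Exchange (minor _ R K) (inj₁ r) = not (inImage R r)
Exchange (minor _ R K) (inj₂ c) = inImage K c

size-Exchange : ∀ (m : Minor p q) →
  Injective _≡_ _≡_ (Minor.rows m) → Injective _≡_ _≡_ (Minor.cols m) → size (Exchange m) ≡ suc p
size-Exchange {p} {q} (minor k R K) R-inj K-inj = begin
  countMaybe p (not ∘ inImage R) + countMaybe q (inImage K)
    ≡⟨ cong (countMaybe p (not ∘ inImage R) +_)
            (trans (countMaybe-image q K K-inj) (sym (countMaybe-image p R R-inj))) ⟩
  countMaybe p (not ∘ inImage R) + countMaybe p (inImage R)
    ≡⟨ countFin-not (suc p) (inImage R ∘ toMaybe) ⟩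
  suc p ∎
  where open ≡-Reasoning

_*ᵥ_ : Mat k k → Vec GF4 k → Fin k → GF4
(M *ᵥ u) s = sumFin _ (λ t → M s t ⊗ lookup u t)

Nonsingular : Mat k k → Set
Nonsingular M = ∀ u → (∀ s → (M *ᵥ u) s ≡ 𝟘) → ∀ t → lookup u t ≡ 𝟘

nonsingular-cong : {M N : Mat k k} → (∀ s t → M s t ≡ N s t) → Nonsingular M ⇔ Nonsingular N
nonsingular-cong M≗N = mk⇔ (transport M≗N) (transport (λ s t → sym (M≗N s t)))
  where
  transport : ∀ {M N : Mat k k} → (∀ s t → M s t ≡ N s t) → Nonsingular M → Nonsingular N
  transport M≗N M-ns u Nu≡0 =
    M-ns u (λ s → trans (sumFin-cong _ (λ t → cong (_⊗ lookup u t) (M≗N s t))) (Nu≡0 s))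

∀-Vec? : ∀ k {P : Vec GF4 k → Set} → (∀ u → Dec (P u)) → Dec (∀ u → P u)
∀-Vec? zero    P? = map′ (λ { p [] → p }) (λ h → h []) (P? [])
∀-Vec? (suc k) P? = map′ (λ { h (x ∷ u) → h x u }) (λ h x u → h (x ∷ u))
                         (∀-GF4? λ x → ∀-Vec? k (λ u → P? (x ∷ u)))

nonsingular? : (M : Mat k k) → Dec (Nonsingular M)
nonsingular? M = ∀-Vec? _ λ u →
  Fin.all? (λ s → (M *ᵥ u) s ≟ 𝟘) →-dec Fin.all? (λ t → lookup u t ≟ 𝟘)

module _ (C : Row p → Col q → GF4) {k} {R : Fin k → Row p} {K : Fin k → Col q}
         (R-inj : Injective _≡_ _≡_ R) (K-inj : Injective _≡_ _≡_ K) where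

  private
    rowSum : Vec GF4 k → Row p → GF4
    rowSum u i = sumFin k (λ t → C i (K t) ⊗ lookup u t)

    spread : Vec GF4 k → Col q → GF4
    spread u col = sumFin k (λ t → lookup u t ⊗ δ (K t) col)

    spread-at : ∀ u s → spread u (K s) ≡ lookup u s
    spread-at u s = trans (sumFin-select k _ s (λ t t≢s → ⊗-δ-≢ (lookup u t) (t≢s ∘ K-inj)))
                          (⊗-δ-refl (lookup u s) (K s))

    spread-outside : ∀ u {col} → (∀ t → K t ≢ col) → spread u col ≡ 𝟘
    spread-outside u col∉K = sumFin-zero k (λ t → ⊗-δ-≢ (lookup u t) (col∉K t))

    lincomb-spread : ∀ (c : Ground p q → GF4) u → (∀ col → c (inj₂ col) ≡ spread u col) →
      ∀ i → lincomb C c i ≡ c (inj₁ i) ⊕ rowSum u i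
    lincomb-spread c u c≡spread i = cong₂ _⊕_ rows-part cols-part
      where
      open ≡-Reasoning
      rows-part : sumMaybe p (λ r → c (inj₁ r) ⊗ column C (inj₁ r) i) ≡ c (inj₁ i)
      rows-part = begin
        sumMaybe p (λ r → c (inj₁ r) ⊗ column C (inj₁ r) i)
          ≡⟨ sumMaybe-cong p (λ r → cong (c (inj₁ r) ⊗_) (column-identity C r i)) ⟩
        sumMaybe p (λ r → c (inj₁ r) ⊗ δ r i)
          ≡⟨ sumMaybe-select p _ i (λ r r≢i → ⊗-δ-≢ (c (inj₁ r)) r≢i) ⟩
        c (inj₁ i) ⊗ δ i i
          ≡⟨ ⊗-δ-refl (c (inj₁ i)) i ⟩
        c (inj₁ i) ∎
      cols-part : sumMaybe q (λ col → c (inj₂ col) ⊗ C i col) ≡ rowSum u i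
      cols-part = begin
        sumMaybe q (λ col → c (inj₂ col) ⊗ C i col)
          ≡⟨ sumMaybe-cong q (λ col → trans (cong (_⊗ C i col) (c≡spread col))
                                            (sumFin-⊗ʳ k _ (C i col))) ⟩
        sumMaybe q (λ col → sumFin k (λ t → (lookup u t ⊗ δ (K t) col) ⊗ C i col))
          ≡⟨ sumMaybe-sumFin-comm q k (λ col t → (lookup u t ⊗ δ (K t) col) ⊗ C i col) ⟩
        sumFin k (λ t → sumMaybe q (λ col → (lookup u t ⊗ δ (K t) col) ⊗ C i col))
          ≡⟨ sumFin-cong k (λ t → sumMaybe-select q _ (K t)
               (λ col col≢Kt → cong (_⊗ C i col) (⊗-δ-≢ (lookup u t) (col≢Kt ∘ sym)))) ⟩
        sumFin k (λ t → (lookup u t ⊗ δ (K t) (K t)) ⊗ C i (K t))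
          ≡⟨ sumFin-cong k (λ t → trans (cong (_⊗ C i (K t)) (⊗-δ-refl (lookup u t) (K t)))
                                         (⊗-comm (lookup u t) (C i (K t)))) ⟩
        rowSum u i ∎

  nonsingular-if-independent : Independent C (Exchange (minor k R K)) → Nonsingular (C [ minor k R K ])
  nonsingular-if-independent independent u Mu≡0 t = begin
      lookup u t      ≡⟨ sym (spread-at u t) ⟩
      spread u (K t)  ≡⟨ independent c outside-zero combination-zero (inj₂ (K t)) ⟩
      𝟘               ∎
    where
    open ≡-Reasoning
    -- Row i receives rowSum u i from its identity column and again from C; in
    -- characteristic 2 the two cancel.
    c : Ground p q → GF4
    c (inj₁ r)   = rowSum u r
    c (inj₂ col) = spread u col
    outside-zero : ∀ x → Exchange (minor k R K) x ≡ false → c x ≡ 𝟘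
    outside-zero (inj₁ r) with Fin.any? (λ s → R s ≟ᵐ r)
    ... | yes (s , refl) = λ _ → Mu≡0 s
    ... | no _           = λ ()
    outside-zero (inj₂ col) with Fin.any? (λ t → K t ≟ᵐ col)
    ... | yes _    = λ ()
    ... | no col∉K = λ _ → spread-outside u (λ t Kt≡col → col∉K (t , Kt≡col))
    combination-zero : ∀ i → lincomb C c i ≡ 𝟘
    combination-zero i = trans (lincomb-spread c u (λ _ → refl) i) (x⊕x≡𝟘 (rowSum u i))

  independent-if-nonsingular : Nonsingular (C [ minor k R K ]) → Independent C (Exchange (minor k R K))
  independent-if-nonsingular nonsingular c outside-zero combination-zero = c≡0
    where
    u : Vec GF4 k
    u = tabulate (λ t → c (inj₂ (K t)))
    c≡spread : ∀ col → c (inj₂ col) ≡ spread u col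
    c≡spread col with Fin.any? (λ t → K t ≟ᵐ col) | outside-zero (inj₂ col)
    ... | yes (s , refl) | _ = trans (sym (lookup∘tabulate _ s)) (sym (spread-at u s))
    ... | no col∉K | c≡0 = trans (c≡0 refl) (sym (spread-outside u (λ t Kt≡col → col∉K (t , Kt≡col))))
    rows-balance : ∀ i → c (inj₁ i) ⊕ rowSum u i ≡ 𝟘
    rows-balance i = trans (sym (lincomb-spread c u c≡spread i)) (combination-zero i)
    c-rows-zero : ∀ s → c (inj₁ (R s)) ≡ 𝟘
    c-rows-zero s = outside-zero (inj₁ (R s)) (cong not (inImage-true R refl))
    u≡0 : ∀ t → lookup u t ≡ 𝟘
    u≡0 = nonsingular u (λ s → trans (cong (_⊕ rowSum u (R s)) (sym (c-rows-zero s))) (rows-balance (R s)))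
    rowSum≡0 : ∀ i → rowSum u i ≡ 𝟘
    rowSum≡0 i = sumFin-zero k (λ t → trans (cong (C i (K t) ⊗_) (u≡0 t)) (⊗-zeroʳ (C i (K t))))
    c≡0 : ∀ x → c x ≡ 𝟘
    c≡0 (inj₁ i)   = begin
      c (inj₁ i)               ≡⟨ ⊕-identityʳ _ ⟨
      c (inj₁ i) ⊕ 𝟘           ≡⟨ cong (c (inj₁ i) ⊕_) (rowSum≡0 i) ⟨
      c (inj₁ i) ⊕ rowSum u i  ≡⟨ rows-balance i ⟩
      𝟘                        ∎
      where open ≡-Reasoning
    c≡0 (inj₂ col) = trans (c≡spread col) (sumFin-zero k (λ t → cong (_⊗ δ (K t) col) (u≡0 t)))

  independent⇔nonsingular : Independent C (Exchange (minor k R K)) ⇔ Nonsingular (C [ minor k R K ])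
  independent⇔nonsingular = mk⇔ nonsingular-if-independent independent-if-nonsingular

RepresentsRelaxation : (C C′ : Row p → Col q → GF4) → Subset p q → Set
RepresentsRelaxation C C′ X =
  ∀ S → (IsBasis C′ S → IsRelaxedBasis C X S) × (IsRelaxedBasis C X S → IsBasis C′ S)

relaxation-independent : ∀ {C C′ : Row p → Col q → GF4} {X S} → RepresentsRelaxation C C′ X →
  size S ≡ suc p → ¬ (S ≐ X) → Independent C S ⇔ Independent C′ S
relaxation-independent {S = S} relaxed |S|≡r S≢X = mk⇔
  (λ independent  → proj₁ (proj₂ (relaxed S) (inj₁ (independent , |S|≡r))))
  (λ independent′ → [ proj₁ , ⊥-elim ∘ S≢X ] (proj₁ (relaxed S) (independent′ , |S|≡r)))

MeetsA : Minor p q → Set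
MeetsA (minor _ R K) = (∃₂ λ s i → R s ≡ just i) ⊎ (∃₂ λ t j → K t ≡ just j)

exchange-≢-X : ∀ (m : Minor p q) → MeetsA m → ¬ (Exchange m ≐ Xset)
exchange-≢-X (minor _ R K) (inj₁ (s , i , Rs≡i)) E≐X =
  contradiction (trans (cong not (sym (inImage-true R Rs≡i))) (E≐X (inj₁ (just i)))) λ ()
exchange-≢-X (minor _ R K) (inj₂ (t , j , Kt≡j)) E≐X =
  contradiction (trans (sym (inImage-true K Kt≡j)) (E≐X (inj₂ (just j)))) λ ()

IsProper : Minor p q → Set
IsProper m = Injective _≡_ _≡_ (Minor.rows m) × Injective _≡_ _≡_ (Minor.cols m) × MeetsA m

relaxation-preserves-nonsingular : ∀ {C C′ : Row p → Col q → GF4} → RepresentsRelaxation C C′ Xset →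
  ∀ m → IsProper m → Nonsingular (C [ m ]) ⇔ Nonsingular (C′ [ m ])
relaxation-preserves-nonsingular {C = C} {C′} relaxed m@(minor _ R K) (R-inj , K-inj , meets) = begin
  Nonsingular (C [ m ])
    ≈⟨ independent⇔nonsingular C R-inj K-inj ⟨
  Independent C (Exchange m)
    ≈⟨ relaxation-independent {C = C} {C′} relaxed (size-Exchange m R-inj K-inj) (exchange-≢-X m meets) ⟩
  Independent C′ (Exchange m)
    ≈⟨ independent⇔nonsingular C′ R-inj K-inj ⟩
  Nonsingular (C′ [ m ]) ∎
  where open SetoidReasoning (⇔-setoid 0ℓ)

-- The frame: the 3×3 submatrix on rows i₁, i₂, f and columns j₁, j₂, e

matrix₂ : GF4 → GF4 → GF4 → GF4 → Mat 2 2
matrix₂ a b c d zero       zero       = a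
matrix₂ a b c d zero       (suc zero) = b
matrix₂ a b c d (suc zero) zero       = c
matrix₂ a b c d (suc zero) (suc zero) = d

submatrix₂ : Mat p q → (Fin 2 → Fin p) → (Fin 2 → Fin q) → Mat 2 2
submatrix₂ A ι κ = matrix₂ (A (ι zero) (κ zero)) (A (ι zero) (κ (suc zero)))
                           (A (ι (suc zero)) (κ zero)) (A (ι (suc zero)) (κ (suc zero)))

bordered-submatrix₂ : ∀ (A : Mat p q) d ι κ r c →
  bordered A d (Maybe.map ι r) (Maybe.map κ c) ≡ bordered (submatrix₂ A ι κ) d r c
bordered-submatrix₂ A d ι κ nothing           nothing           = refl
bordered-submatrix₂ A d ι κ nothing           (just _)          = refl
bordered-submatrix₂ A d ι κ (just _)          nothing           = refl
bordered-submatrix₂ A d ι κ (just zero)       (just zero)       = refl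
bordered-submatrix₂ A d ι κ (just zero)       (just (suc zero)) = refl
bordered-submatrix₂ A d ι κ (just (suc zero)) (just zero)       = refl
bordered-submatrix₂ A d ι κ (just (suc zero)) (just (suc zero)) = refl

mapMinor : (Fin 2 → Fin p) → (Fin 2 → Fin q) → Minor 2 2 → Minor p q
mapMinor ι κ (minor k R K) = minor k (Maybe.map ι ∘ R) (Maybe.map κ ∘ K)

map-injective : {f : Fin n → Fin p} → Injective _≡_ _≡_ f → Injective _≡_ _≡_ (Maybe.map f)
map-injective f-inj {nothing} {nothing} _  = refl
map-injective f-inj {just _}  {just _}  eq = cong just (f-inj (Maybe.just-injective eq))

mapMinor-proper : {ι : Fin 2 → Fin p} {κ : Fin 2 → Fin q} →
  Injective _≡_ _≡_ ι → Injective _≡_ _≡_ κ → ∀ m → IsProper m → IsProper (mapMinor ι κ m)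
mapMinor-proper {ι = ι} {κ} ι-inj κ-inj (minor _ R K) (R-inj , K-inj , meets) =
  (R-inj ∘ map-injective ι-inj) , (K-inj ∘ map-injective κ-inj) , meets′ meets
  where
  meets′ : MeetsA (minor _ R K) → MeetsA (mapMinor ι κ (minor _ R K))
  meets′ (inj₁ (s , i , Rs≡i)) = inj₁ (s , ι i , cong (Maybe.map ι) Rs≡i)
  meets′ (inj₂ (t , j , Kt≡j)) = inj₂ (t , κ j , cong (Maybe.map κ) Kt≡j)

pair-injective : ∀ {x y : Fin n} → x ≢ y → Injective _≡_ _≡_ (lookup (x ∷ y ∷ []))
pair-injective x≢y {zero}     {zero}     _   = refl
pair-injective x≢y {zero}     {suc zero} x≡y = ⊥-elim (x≢y x≡y)
pair-injective x≢y {suc zero} {zero}     y≡x = ⊥-elim (x≢y (sym y≡x))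
pair-injective x≢y {suc zero} {suc zero} _   = refl

meetsA? : (m : Minor p q) → Dec (MeetsA m)
meetsA? (minor _ R K) = Fin.any? (λ s → Fin.any? λ i → R s ≟ᵐ just i)
                  ⊎-dec Fin.any? (λ t → Fin.any? λ j → K t ≟ᵐ just j)

injective? : (f : Fin k → Maybe (Fin n)) → Dec (Injective _≡_ _≡_ f)
injective? f = map′ (λ h {x} {y} → h x y) (λ h x y → h)
                    (Fin.all? λ x → Fin.all? λ y → (f x ≟ᵐ f y) →-dec (x Fin.≟ y))

isProper? : (m : Minor p q) → Dec (IsProper m)
isProper? m = injective? (Minor.rows m) ×-dec injective? (Minor.cols m) ×-dec meetsA? m

-- All square submatrices of the frame except the (f, e) entry.
frameMinors : List (Minor 2 2)
frameMinors = filter meetsA? (squares lines₁ ++ squares lines₂ ++ squares lines₃)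
  where
  a₁ a₂ : Maybe (Fin 2)
  a₁ = just zero
  a₂ = just (suc zero)
  squares : List (Vec (Maybe (Fin 2)) k) → List (Minor 2 2)
  squares ls = cartesianProductWith (λ rs cs → minor _ (lookup rs) (lookup cs)) ls ls
  lines₁ = (a₁ ∷ []) ∷ (a₂ ∷ []) ∷ (nothing ∷ []) ∷ []
  lines₂ = (a₁ ∷ a₂ ∷ []) ∷ (a₁ ∷ nothing ∷ []) ∷ (a₂ ∷ nothing ∷ []) ∷ []
  lines₃ = (a₁ ∷ a₂ ∷ nothing ∷ []) ∷ []

frameMinors-proper : All IsProper frameMinors
frameMinors-proper = from-yes (all? isProper? frameMinors)

MinorsAgree : (C C′ : Row p → Col q → GF4) → List (Minor p q) → Set
MinorsAgree C C′ = All (λ m → Nonsingular (C [ m ]) ⇔ Nonsingular (C′ [ m ]))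

frame-minors-agree : ∀ {A A′ : Mat p q} {w} →
  RepresentsRelaxation (bordered A 𝟘) (bordered A′ w) Xset →
  ∀ ι κ → Injective _≡_ _≡_ ι → Injective _≡_ _≡_ κ →
  MinorsAgree (bordered (submatrix₂ A ι κ) 𝟘) (bordered (submatrix₂ A′ ι κ) w) frameMinors
frame-minors-agree {A = A} {A′} {w} relaxed ι κ ι-inj κ-inj = All.map agree frameMinors-proper
  where
  open SetoidReasoning (⇔-setoid 0ℓ)
  agree : ∀ {m} → IsProper m →
    Nonsingular (bordered (submatrix₂ A ι κ) 𝟘 [ m ]) ⇔
    Nonsingular (bordered (submatrix₂ A′ ι κ) w [ m ])
  agree {m@(minor _ R K)} proper = begin
    Nonsingular (bordered (submatrix₂ A ι κ) 𝟘 [ m ])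
      ≈⟨ nonsingular-cong (λ s t → bordered-submatrix₂ A 𝟘 ι κ (R s) (K t)) ⟨
    Nonsingular (bordered A 𝟘 [ mapMinor ι κ m ])
      ≈⟨ relaxation-preserves-nonsingular {C = bordered A 𝟘} {bordered A′ w} relaxed
           (mapMinor ι κ m) (mapMinor-proper ι-inj κ-inj m proper) ⟩
    Nonsingular (bordered A′ w [ mapMinor ι κ m ])
      ≈⟨ nonsingular-cong (λ s t → bordered-submatrix₂ A′ w ι κ (R s) (K t)) ⟩
    Nonsingular (bordered (submatrix₂ A′ ι κ) w [ m ]) ∎

_⇔?_ : {A B : Set} → Dec A → Dec B → Dec (A ⇔ B)
a? ⇔? b? = map′ (sound a? b?) (complete a? b?) (does a? Bool.≟ does b?)
  where
  sound : {A B : Set} (a? : Dec A) (b? : Dec B) → does a? ≡ does b? → A ⇔ B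
  sound (yes a) (yes b) _  = mk⇔ (λ _ → b) (λ _ → a)
  sound (yes _) (no _)  ()
  sound (no _)  (yes _) ()
  sound (no ¬a) (no ¬b) _  = mk⇔ (⊥-elim ∘ ¬a) (⊥-elim ∘ ¬b)
  complete : {A B : Set} (a? : Dec A) (b? : Dec B) → A ⇔ B → does a? ≡ does b?
  complete (yes _) (yes _) _     = refl
  complete (yes a) (no ¬b) a⇔b = ⊥-elim (¬b (Equivalence.to a⇔b a))
  complete (no ¬a) (yes b) a⇔b = ⊥-elim (¬a (Equivalence.from a⇔b b))
  complete (no _)  (no _)  _     = refl

minorsAgree? : (C C′ : Row p → Col q → GF4) → ∀ ms → Dec (MinorsAgree C C′ ms)
minorsAgree? C C′ = all? (λ m → nonsingular? (C [ m ]) ⇔? nonsingular? (C′ [ m ]))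

forbidden? : ∀ a b c d → Dec (Forbidden a b c d)
forbidden? a b c d =
        (∃-GF4? λ x → ∃-GF4? λ y →
           distinct₂? x y ×-dec a ≟ x ×-dec b ≟ y ×-dec c ≟ 𝟘 ×-dec d ≟ x)
  ⊎-dec (∃-GF4? λ x → ∃-GF4? λ y →
           distinct₂? x y ×-dec a ≟ x ×-dec b ≟ y ×-dec c ≟ y ×-dec d ≟ x)
  ⊎-dec (∃-GF4? λ x → ∃-GF4? λ y → ∃-GF4? λ z →
           distinct₃? x y z ×-dec a ≟ x ×-dec b ≟ x ×-dec c ≟ y ×-dec d ≟ z)
  ⊎-dec (∃-GF4? λ x → ∃-GF4? λ y → ∃-GF4? λ z →
           distinct₃? x y z ×-dec a ≟ x ×-dec b ≟ y ×-dec c ≟ z ×-dec d ≟ x)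
  where
  distinct₂? : ∀ x y → Dec (NZDistinct2 x y)
  distinct₂? x y = ¬? (x ≟ 𝟘) ×-dec ¬? (y ≟ 𝟘) ×-dec ¬? (x ≟ y)
  distinct₃? : ∀ x y z → Dec (NZDistinct3 x y z)
  distinct₃? x y z = distinct₂? x y ×-dec ¬? (z ≟ 𝟘) ×-dec ¬? (x ≟ z) ×-dec ¬? (y ≟ z)

frame-inconsistent : ∀ a b c d → Forbidden a b c d → ∀ a′ b′ c′ d′ w → w ≢ 𝟘 → w ≢ 𝟙 →
  ¬ MinorsAgree (bordered (matrix₂ a b c d) 𝟘) (bordered (matrix₂ a′ b′ c′ d′) w) frameMinors
frame-inconsistent = from-yes
  (∀-GF4? λ a → ∀-GF4? λ b → ∀-GF4? λ c → ∀-GF4? λ d → forbidden? a b c d →-dec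
   ∀-GF4? λ a′ → ∀-GF4? λ b′ → ∀-GF4? λ c′ → ∀-GF4? λ d′ → ∀-GF4? λ w →
   ¬? (w ≟ 𝟘) →-dec ¬? (w ≟ 𝟙) →-dec
   ¬? (minorsAgree? (bordered (matrix₂ a b c d) 𝟘) (bordered (matrix₂ a′ b′ c′ d′) w) frameMinors))

lemma6p7 : (p q : ℕ) (A A′ : Mat p q) (w : GF4) →
    IsCircuitHyperplane (bordered A 𝟘) Xset →
    w ≢ 𝟘 → w ≢ 𝟙 →
    (∀ S → (IsBasis (bordered A′ w) S → IsRelaxedBasis (bordered A 𝟘) Xset S)
         × (IsRelaxedBasis (bordered A 𝟘) Xset S → IsBasis (bordered A′ w) S)) →
    ¬ HasForbiddenSubmatrix A
lemma6p7 p q A A′ w _ w≢𝟘 w≢𝟙 relaxed (i₁ , i₂ , j₁ , j₂ , i₁≢i₂ , j₁≢j₂ , forbidden) =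
  frame-inconsistent _ _ _ _ forbidden _ _ _ _ w w≢𝟘 w≢𝟙
    (frame-minors-agree relaxed (lookup (i₁ ∷ i₂ ∷ [])) (lookup (j₁ ∷ j₂ ∷ []))
                        (pair-injective i₁≢i₂) (pair-injective j₁≢j₂))
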